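{- For every non-negative integer $n$, $$\sum_{k=0}^n\binom{2n}{k}\binom{2n+1}{k}+\sum_{k=n+1}^{2n+1}\binom{2n}{k-1}\binom{2n+1}{k}=\binom{4n+1}{2n}+\binom{2n}{n}^2.$$
   Context: Convention: $\binom{N}{k}=0$ whenever $k<0$ or $k>N$. -}

module Defs where

open import Data.Nat using (ℕ; zero; suc; _+_)

sumCount : ℕ → ℕ → (ℕ → ℕ) → ℕ
sumCount a zero    f = 0
sumCount a (suc m) f = f a + sumCount (suc a) m f

-- Σ_{k=a}^{a+m-1} f k ; the inclusive range [a, b] is sumCount a (b + 1 - a)

-- Write N = 2n. Pascal's rule C(N+1,k) = C(N,k) + C(N,k-1) splits every summand into a square and
-- a cross term C(N,k) C(N,k-1). The cross terms of both sums together run over all k and give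
-- C(2N,N+1) by Vandermonde's convolution and symmetry; the squares C(N,k)² (k ≤ n) and C(N,k-1)²
-- (k > n) cover 0..N with C(N,n)² counted twice, and Σ C(N,k)² = C(2N,N). Since
-- C(2N,N) + C(2N,N+1) = C(2N+1,N), the identity holds for any split point n ≤ N, not only n = N/2.
module Submission where

open import Defs
open import Data.Nat using (ℕ; zero; suc; _+_; _*_; _∸_; _≤_; _<_; s≤s; z<s)
open import Data.Nat.Properties
open import Data.Nat.Combinatorics using (_C_; nCk≡nC[n∸k]; nCk+nC[k+1]≡[n+1]C[k+1]; k>n⇒nCk≡0)
open import Algebra.Properties.CommutativeSemigroup +-commutativeSemigroup using (interchange; xy∙z≈xz∙y)
open import Relation.Binary.PropositionalEquality using (_≡_; refl; sym; trans; cong; cong₂; module ≡-Reasoning)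

sumCount-cong : ∀ a m {f g : ℕ → ℕ} → (∀ k → a ≤ k → k < a + m → f k ≡ g k) →
                sumCount a m f ≡ sumCount a m g
sumCount-cong a zero    eq = refl
sumCount-cong a (suc m) eq = cong₂ _+_ (eq a ≤-refl (m<m+n a z<s))
  (sumCount-cong (suc a) m (λ k a<k k<a+1+m → eq k (<⇒≤ a<k) (≤-trans k<a+1+m (≤-reflexive (sym (+-suc a m))))))

sumCount-zero : ∀ a m → sumCount a m (λ _ → 0) ≡ 0
sumCount-zero a zero    = refl
sumCount-zero a (suc m) = sumCount-zero (suc a) m

sumCount-+ : ∀ a m (f g : ℕ → ℕ) → sumCount a m (λ k → f k + g k) ≡ sumCount a m f + sumCount a m g
sumCount-+ a zero    f g = refl
sumCount-+ a (suc m) f g =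
  trans (cong (f a + g a +_) (sumCount-+ (suc a) m f g))
        (interchange (f a) (g a) (sumCount (suc a) m f) (sumCount (suc a) m g))

sumCount-suc : ∀ a m (f : ℕ → ℕ) → sumCount (suc a) m f ≡ sumCount a m (λ k → f (suc k))
sumCount-suc a zero    f = refl
sumCount-suc a (suc m) f = cong (f (suc a) +_) (sumCount-suc (suc a) m f)

sumCount-split : ∀ a m p (f : ℕ → ℕ) → sumCount a (m + p) f ≡ sumCount a m f + sumCount (a + m) p f
sumCount-split a zero    p f rewrite +-identityʳ a = refl
sumCount-split a (suc m) p f rewrite +-suc a m =
  trans (cong (f a +_) (sumCount-split (suc a) m p f)) (sym (+-assoc (f a) _ _))

sumCount-snoc : ∀ a m (f : ℕ → ℕ) → sumCount a (suc m) f ≡ sumCount a m f + f (a + m)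
sumCount-snoc a m f = begin
  sumCount a (suc m) f                      ≡⟨ cong (λ l → sumCount a l f) (+-comm 1 m) ⟩
  sumCount a (m + 1) f                      ≡⟨ sumCount-split a m 1 f ⟩
  sumCount a m f + (f (a + m) + 0)          ≡⟨ cong (sumCount a m f +_) (+-identityʳ _) ⟩
  sumCount a m f + f (a + m)                ∎
  where open ≡-Reasoning

-- shift (N C_) k is C(N,k-1) with the convention C(N,-1) = 0, whereas N C (k ∸ 1) is 1 at k = 0.
shift : (ℕ → ℕ) → ℕ → ℕ
shift f zero    = 0
shift f (suc k) = f k

shift-cong : ∀ {f g : ℕ → ℕ} → (∀ k → f k ≡ g k) → ∀ k → shift f k ≡ shift g k
shift-cong eq zero    = refl
shift-cong eq (suc k) = eq k

pascal : ∀ a k → suc a C k ≡ a C k + shift (a C_) k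
pascal a zero    = refl
pascal a (suc k) = trans (sym (nCk+nC[k+1]≡[n+1]C[k+1] a k)) (+-comm (a C k) (a C suc k))

shift-C-symmetric : ∀ N k → k ≤ suc N → shift (N C_) k ≡ N C (suc N ∸ k)
shift-C-symmetric N zero    _         = sym (k>n⇒nCk≡0 (n<1+n N))
shift-C-symmetric N (suc k) (s≤s k≤N) = nCk≡nC[n∸k] k≤N

convolution : (ℕ → ℕ) → (ℕ → ℕ) → ℕ → ℕ
convolution f g m = sumCount 0 (suc m) (λ k → f k * g (m ∸ k))

convolution-congˡ : ∀ {f f′ : ℕ → ℕ} g m → (∀ k → f k ≡ f′ k) → convolution f g m ≡ convolution f′ g m
convolution-congˡ g m eq = sumCount-cong 0 (suc m) (λ k _ _ → cong (_* g (m ∸ k)) (eq k))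

convolution-+ˡ : ∀ (f f′ g : ℕ → ℕ) m →
                 convolution (λ k → f k + f′ k) g m ≡ convolution f g m + convolution f′ g m
convolution-+ˡ f f′ g m = trans
  (sumCount-cong 0 (suc m) (λ k _ _ → *-distribʳ-+ (g (m ∸ k)) (f k) (f′ k)))
  (sumCount-+ 0 (suc m) (λ k → f k * g (m ∸ k)) (λ k → f′ k * g (m ∸ k)))

convolution-shiftˡ : ∀ (f g : ℕ → ℕ) m → convolution (shift f) g m ≡ shift (convolution f g) m
convolution-shiftˡ f g zero    = refl
convolution-shiftˡ f g (suc m) = sumCount-suc 0 (suc m) (λ k → shift f k * g (suc m ∸ k))

convolution-0Cˡ : ∀ (g : ℕ → ℕ) m → convolution (0 C_) g m ≡ g m
convolution-0Cˡ g zero    = trans (+-identityʳ (g 0 + 0)) (+-identityʳ (g 0))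
convolution-0Cˡ g (suc m) = begin
  g (suc m) + 0 + sumCount 1 (suc m) (λ k → (0 C k) * g (suc m ∸ k))
    ≡⟨ cong₂ _+_ (+-identityʳ (g (suc m))) (sumCount-suc 0 (suc m) (λ k → (0 C k) * g (suc m ∸ k))) ⟩
  g (suc m) + sumCount 0 (suc m) (λ _ → 0)
    ≡⟨ cong (g (suc m) +_) (sumCount-zero 0 (suc m)) ⟩
  g (suc m) + 0
    ≡⟨ +-identityʳ (g (suc m)) ⟩
  g (suc m) ∎
  where open ≡-Reasoning

vandermonde : ∀ a b m → convolution (a C_) (b C_) m ≡ (a + b) C m
vandermonde zero    b m = convolution-0Cˡ (b C_) m
vandermonde (suc a) b m = begin
  convolution (suc a C_) (b C_) m
    ≡⟨ convolution-congˡ (b C_) m (pascal a) ⟩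
  convolution (λ k → a C k + shift (a C_) k) (b C_) m
    ≡⟨ convolution-+ˡ (a C_) (shift (a C_)) (b C_) m ⟩
  convolution (a C_) (b C_) m + convolution (shift (a C_)) (b C_) m
    ≡⟨ cong₂ _+_ (vandermonde a b m)
                 (trans (convolution-shiftˡ (a C_) (b C_) m) (shift-cong (vandermonde a b) m)) ⟩
  (a + b) C m + shift ((a + b) C_) m
    ≡⟨ sym (pascal (a + b) m) ⟩
  suc (a + b) C m ∎
  where open ≡-Reasoning

sum-NCk²≡[2N]CN : ∀ N → sumCount 0 (suc N) (λ k → (N C k) * (N C k)) ≡ (N + N) C N
sum-NCk²≡[2N]CN N = trans
  (sumCount-cong 0 (suc N) (λ k _ k<1+N → cong ((N C k) *_) (nCk≡nC[n∸k] (≤-pred k<1+N))))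
  (vandermonde N N N)

sum-NCk*NC[k-1]≡[2N]C[N+1] : ∀ N → sumCount 0 (suc (suc N)) (λ k → (N C k) * shift (N C_) k) ≡ (N + N) C suc N
sum-NCk*NC[k-1]≡[2N]C[N+1] N = trans
  (sumCount-cong 0 (suc (suc N)) (λ k _ k<2+N → cong ((N C k) *_) (shift-C-symmetric N k (≤-pred k<2+N))))
  (vandermonde N N (suc N))

[2N]CN+[2N]C[N+1]≡[2N+1]CN : ∀ N → (N + N) C N + (N + N) C suc N ≡ suc (N + N) C N
[2N]CN+[2N]C[N+1]≡[2N+1]CN N = begin
  (N + N) C N + (N + N) C suc N  ≡⟨ nCk+nC[k+1]≡[n+1]C[k+1] (N + N) N ⟩
  suc (N + N) C suc N            ≡⟨ nCk≡nC[n∸k] (s≤s (m≤m+n N N)) ⟩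
  suc (N + N) C (N + N ∸ N)      ≡⟨ cong (suc (N + N) C_) (m+n∸n≡m N N) ⟩
  suc (N + N) C N                ∎
  where open ≡-Reasoning

module _ (N n m : ℕ) (n+m≡N : n + m ≡ N) where
  open ≡-Reasoning

  private
    P Q : ℕ → ℕ
    P = N C_
    Q = shift P

    PP PQ QP QQ : ℕ → ℕ
    PP k = P k * P k
    PQ k = P k * Q k
    QP k = Q k * P k
    QQ k = Q k * Q k

    n+[1+m]≡1+N : n + suc m ≡ suc N
    n+[1+m]≡1+N = trans (+-suc n m) (cong suc n+m≡N)

  split-sum-NCk² : sumCount 0 (suc n) PP + sumCount (suc n) (suc m) QQ
                   ≡ (N + N) C N + P n * P n
  split-sum-NCk² = begin
    sumCount 0 (suc n) PP + sumCount (suc n) (suc m) QQ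
      ≡⟨ cong₂ _+_ (sumCount-snoc 0 n PP) (sumCount-suc n (suc m) QQ) ⟩
    (sumCount 0 n PP + PP n) + sumCount n (suc m) PP
      ≡⟨ xy∙z≈xz∙y (sumCount 0 n PP) (PP n) (sumCount n (suc m) PP) ⟩
    (sumCount 0 n PP + sumCount n (suc m) PP) + PP n
      ≡⟨ cong (_+ PP n) (sym (sumCount-split 0 n (suc m) PP)) ⟩
    sumCount 0 (n + suc m) PP + PP n
      ≡⟨ cong (λ l → sumCount 0 l PP + PP n) n+[1+m]≡1+N ⟩
    sumCount 0 (suc N) PP + PP n
      ≡⟨ cong (_+ PP n) (sum-NCk²≡[2N]CN N) ⟩
    (N + N) C N + PP n ∎

  split-sum-NCk*NC[k-1] : sumCount 0 (suc n) PQ + sumCount (suc n) (suc m) QP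
                          ≡ (N + N) C suc N
  split-sum-NCk*NC[k-1] = begin
    sumCount 0 (suc n) PQ + sumCount (suc n) (suc m) QP
      ≡⟨ cong (sumCount 0 (suc n) PQ +_) (sumCount-cong (suc n) (suc m) (λ k _ _ → *-comm (Q k) (P k))) ⟩
    sumCount 0 (suc n) PQ + sumCount (suc n) (suc m) PQ
      ≡⟨ sym (sumCount-split 0 (suc n) (suc m) PQ) ⟩
    sumCount 0 (suc (n + suc m)) PQ
      ≡⟨ cong (λ l → sumCount 0 (suc l) PQ) n+[1+m]≡1+N ⟩
    sumCount 0 (suc (suc N)) PQ
      ≡⟨ sum-NCk*NC[k-1]≡[2N]C[N+1] N ⟩
    (N + N) C suc N ∎

  split-sum-NCk*[1+N]Ck : sumCount 0 (suc n) (λ k → (N C k) * (suc N C k))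
                            + sumCount (suc n) (suc m) (λ k → (N C (k ∸ 1)) * (suc N C k))
                          ≡ suc (N + N) C N + (N C n) * (N C n)
  split-sum-NCk*[1+N]Ck = begin
    sumCount 0 (suc n) (λ k → P k * (suc N C k)) + sumCount (suc n) (suc m) (λ k → P (k ∸ 1) * (suc N C k))
      ≡⟨ cong₂ _+_ lower upper ⟩
    (sumCount 0 (suc n) PP + sumCount 0 (suc n) PQ) + (sumCount (suc n) (suc m) QQ + sumCount (suc n) (suc m) QP)
      ≡⟨ interchange (sumCount 0 (suc n) PP) _ _ _ ⟩
    (sumCount 0 (suc n) PP + sumCount (suc n) (suc m) QQ) + (sumCount 0 (suc n) PQ + sumCount (suc n) (suc m) QP)
      ≡⟨ cong₂ _+_ split-sum-NCk² split-sum-NCk*NC[k-1] ⟩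
    ((N + N) C N + P n * P n) + (N + N) C suc N
      ≡⟨ xy∙z≈xz∙y ((N + N) C N) (P n * P n) ((N + N) C suc N) ⟩
    ((N + N) C N + (N + N) C suc N) + P n * P n
      ≡⟨ cong (_+ P n * P n) ([2N]CN+[2N]C[N+1]≡[2N+1]CN N) ⟩
    suc (N + N) C N + P n * P n ∎
    where
    lower : sumCount 0 (suc n) (λ k → P k * (suc N C k)) ≡ sumCount 0 (suc n) PP + sumCount 0 (suc n) PQ
    lower = trans
      (sumCount-cong 0 (suc n) (λ k _ _ → trans (cong (P k *_) (pascal N k)) (*-distribˡ-+ (P k) (P k) (Q k))))
      (sumCount-+ 0 (suc n) PP PQ)

    upper : sumCount (suc n) (suc m) (λ k → P (k ∸ 1) * (suc N C k))
            ≡ sumCount (suc n) (suc m) QQ + sumCount (suc n) (suc m) QP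
    upper = trans (sumCount-cong (suc n) (suc m) pointwise) (sumCount-+ (suc n) (suc m) QQ QP)
      where
      pointwise : ∀ k → suc n ≤ k → k < suc n + suc m → P (k ∸ 1) * (suc N C k) ≡ QQ k + QP k
      pointwise (suc k) _ _ =
        trans (cong (P k *_) (trans (pascal N (suc k)) (+-comm (P (suc k)) (P k))))
              (*-distribˡ-+ (P k) (P k) (P (suc k)))

4n+1≡1+2n+2n : ∀ n → 4 * n + 1 ≡ suc (2 * n + 2 * n)
4n+1≡1+2n+2n n = trans (+-comm (4 * n) 1) (cong suc (*-distribʳ-+ n 2 2))

corollary3p3 : (n : ℕ) →
    sumCount 0 (suc n) (λ k → ((2 * n) C k) * ((2 * n + 1) C k))
      + sumCount (suc n) (suc n) (λ k → ((2 * n) C (k ∸ 1)) * ((2 * n + 1) C k))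
      ≡ ((4 * n + 1) C (2 * n)) + ((2 * n) C n) * ((2 * n) C n)
corollary3p3 n rewrite +-comm (2 * n) 1 | 4n+1≡1+2n+2n n =
  split-sum-NCk*[1+N]Ck (2 * n) n n (cong (n +_) (sym (+-identityʳ n)))
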